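{- Let $\mathcal D\subseteq\mathcal L(A)$ be a peak-pit Condorcet domain and let $a,b,c\in A$ be distinct. (a) If $abc,cab\in\mathcal D_{\{a,b,c\}}$, then $\mathcal D_{\{a,b,c\}}\cup\{acb\}$ is a peak-pit Condorcet domain. If $abc,bca\in\mathcal D_{\{a,b,c\}}$, then $\mathcal D_{\{a,b,c\}}\cup\{bac\}$ is a peak-pit Condorcet domain. (b) If $R,T\in\mathcal D_{\{a,b,c\}}$ differ by at most two swaps of adjacent alternatives (i.e. at most two pairs of alternatives are ranked differently by $R$ and $T$), then there is exactly one geodesic $\mathcal A$ on $\mathcal L(\{a,b,c\})$ connecting them, and $\mathcal D_{\{a,b,c\}}\cup K(\mathcal A)$ is a peak-pit Condorcet domain. (c) If $R,T\in\mathcal D_{\{a,b,c\}}$ differ by three swaps of adjacent alternatives, then there are exactly two geodesics on $\mathcal L(\{a,b,c\})$ connecting them, and for at least one of them, $\mathcal A$, the set $\mathcal D_{\{a,b,c\}}\cup K(\mathcal A)$ is a peak-pit Condorcet domain. (d) For all $R,T\in\mathcal D_{\{a,b,c\}}$ there is a geodesic $\mathcal A$ connecting $R$ and $T$ such that $\mathcal D_{\{a,b,c\}}\cup K(\mathcal A)$ is a peak-pit Condorcet domain.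
   Context: $A$ is finite, $\mathcal L(A)$ is the set of linear orders on $A$ written as words from top to bottom, and $\mathcal D_{\{a,b,c\}}$ is the set of restrictions of orders of $\mathcal D$ to $\{a,b,c\}$. A domain satisfies the never-condition $xN_{\{a,b,c\}}k$ if none of its orders restricted to $\{a,b,c\}$ has $x$ in position $k$; a domain is a peak-pit Condorcet domain if for each triple of distinct alternatives its restriction satisfies such a condition with $k=1$ or $k=3$. Two linear orders are alike if they differ by a swap of two alternatives in adjacent positions. A path connecting $R$ and $T$ is a sequence $(R_1,\dots,R_k)$ with $R_1=R$, $R_k=T$, consecutive orders alike, and $K(\mathcal A)=\{R_1,\dots,R_k\}$; a geodesic is such a path of minimum length. -}

module Defs where

open import Data.Nat using (ℕ; zero; suc; _+_; _≤_)
open import Data.Unit using (⊤)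
open import Data.Bool using (Bool; true; false; if_then_else_; _∨_)
open import Data.Fin using (Fin; _≟_)
open import Data.List using (List; []; _∷_; filter; length; head; last)
open import Data.List.Membership.Propositional using (_∈_)
open import Data.List.Relation.Unary.All using (All)
open import Data.List.Relation.Unary.Unique.Propositional using (Unique)
open import Data.List.Relation.Unary.Linked using (Linked)
open import Data.Maybe using (Maybe; just; nothing)
open import Data.Product using (Σ; ∃; _×_; _,_)
open import Data.Sum using (_⊎_)
open import Relation.Nullary using (¬_; Dec; does)
open import Relation.Nullary.Decidable using (_⊎-dec_)
open import Relation.Binary.PropositionalEquality using (_≡_; _≢_)

-- Alternatives: the finite set A is Fin n.
-- A linear order is written as a word (list) from top to bottom.
Word : ℕ → Set
Word n = List (Fin n)

IsLinOrderOn : ∀ {n} → (Fin n → Set) → Word n → Set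
IsLinOrderOn {n} S w = Unique w × (∀ (x : Fin n) → (x ∈ w → S x) × (S x → x ∈ w))

Full : ∀ {n} → Fin n → Set
Full _ = ⊤

Tri : ∀ {n} → Fin n → Fin n → Fin n → Fin n → Set
Tri x y z u = u ≡ x ⊎ u ≡ y ⊎ u ≡ z

tri? : ∀ {n} (x y z u : Fin n) → Dec (Tri x y z u)
tri? x y z u = (u ≟ x) ⊎-dec ((u ≟ y) ⊎-dec (u ≟ z))

restrict : ∀ {n} → Fin n → Fin n → Fin n → Word n → Word n
restrict x y z w = filter (tri? x y z) w

-- Element at position k (1 = top) of a word.
at : ∀ {n} → Word n → ℕ → Maybe (Fin n)
at []      _             = nothing
at (x ∷ w) zero          = nothing
at (x ∷ w) (suc zero)    = just x
at (x ∷ w) (suc (suc k)) = at w (suc k)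

Domain : ℕ → Set₁
Domain n = Word n → Set

Never : ∀ {n} → Domain n → Fin n → Fin n → Fin n → Fin n → ℕ → Set
Never D x y z v k = ∀ w → D w → at (restrict x y z w) k ≢ just v

PeakPit : ∀ {n} → (Fin n → Set) → Domain n → Set
PeakPit S D =
  (∀ w → D w → IsLinOrderOn S w) ×
  (∀ x y z → S x → S y → S z → x ≢ y → y ≢ z → x ≢ z →
     ∃ λ v → ∃ λ k → Tri x y z v × (k ≡ 1 ⊎ k ≡ 3) × Never D x y z v k)

Restr : ∀ {n} → Domain n → Fin n → Fin n → Fin n → Domain n
Restr D a b c w = ∃ λ R → D R × restrict a b c R ≡ w

_∪_ : ∀ {n} → Domain n → Domain n → Domain n
(D ∪ E) w = D w ⊎ E w

｛_｝ : ∀ {n} → Word n → Domain n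
｛ u ｝ w = w ≡ u

data Alike {n} : Word n → Word n → Set where
  here  : ∀ x y w → Alike (x ∷ y ∷ w) (y ∷ x ∷ w)
  there : ∀ z {v w} → Alike v w → Alike (z ∷ v) (z ∷ w)

IsPath : ∀ {n} → (Fin n → Set) → Word n → Word n → List (Word n) → Set
IsPath S R T p = All (IsLinOrderOn S) p × head p ≡ just R × last p ≡ just T × Linked Alike p

IsGeodesic : ∀ {n} → (Fin n → Set) → Word n → Word n → List (Word n) → Set
IsGeodesic S R T p = IsPath S R T p × (∀ q → IsPath S R T q → length p ≤ length q)

K : ∀ {n} → List (Word n) → Domain n
K p w = w ∈ p

elem : ∀ {n} → Fin n → Word n → Bool
elem x []      = false
elem x (z ∷ w) = does (z ≟ x) ∨ elem x w

above : ∀ {n} → Fin n → Fin n → Word n → Bool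
above x y []      = false
above x y (z ∷ w) = if does (z ≟ x) then elem y w
                    else (if does (z ≟ y) then false else above x y w)

-- Number of pairs of alternatives ranked differently by R and T
-- (pairs {x,y} with x above y in R but y above x in T).
countRev : ∀ {n} → Fin n → Word n → Word n → ℕ
countRev x []      T = 0
countRev x (y ∷ R) T = (if above y x T then 1 else 0) + countRev x R T

disc : ∀ {n} → Word n → Word n → ℕ
disc []      T = 0
disc (x ∷ R) T = countRev x R T + disc R T

{-# OPTIONS --safe #-}
-- On three alternatives the six linear orders form a hexagon: alike orders are neighbours, and
-- disc is the path distance on it (an adjacent swap changes disc by at most one). The orders that
-- violate a never condition (v not in position k) are the two with v in position k, and these are
-- neighbours, so the orders satisfying it form an arc of four consecutive vertices. Two orders on
-- this arc are joined by a geodesic inside it: when disc ≤ 2 it is the only geodesic, and for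
-- antipodal orders it is one of the two halves of the hexagon. Adding the orders of such a geodesic
-- to D_{a,b,c} keeps the never condition, and on a three-element set that single condition is a
-- peak-pit condition for every ordering of the triple.
--
-- The geodesics from R to T are exactly the walks of disc R T adjacent swaps from R that end at T.
-- The finitely many facts about the hexagon are decided on Fin 3 and transported to {a, b, c}
-- along the relabelling 0, 1, 2 ↦ a, b, c.
module Submission where

open import Defs
import Data.Nat.Properties as ℕₚ
open import Algebra.Properties.CommutativeSemigroup ℕₚ.+-commutativeSemigroup using (x∙yz≈y∙xz)
open import Data.Bool using (Bool; true; false; if_then_else_)
open import Data.Empty using (⊥-elim)
open import Data.Fin using (Fin; zero; suc; _≟_; #_)
open import Data.Fin.Properties using (all?; any?)
open import Data.List using (List; []; _∷_; map; length; last; filter; concatMap; lookup)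
open import Data.List.Membership.Propositional using (_∈_; lose; find)
open import Data.List.Membership.Propositional.Properties
  using (∈-map⁺; ∈-map⁻; ∈-concatMap⁺; ∈-concatMap⁻; ∈-filter⁺; ∈-filter⁻)
open import Data.List.Membership.DecPropositional (_≟_ {3}) using (_∈?_)
import Data.List.Properties as Listₚ
open import Data.List.Relation.Binary.Permutation.Propositional using (_↭_; prep; swap; ↭-refl; ↭-sym)
open import Data.List.Relation.Binary.Permutation.Propositional.Properties using (All-resp-↭; ∈-resp-↭)
open import Data.List.Relation.Unary.All as All using (All; []; _∷_)
import Data.List.Relation.Unary.All.Properties as All
open import Data.List.Relation.Unary.AllPairs using (_∷_)
open import Data.List.Relation.Unary.Any as Any using (Any; here; there)
open import Data.List.Relation.Unary.Linked as Linked using (Linked; [-]; _∷_)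
import Data.List.Relation.Unary.Linked.Properties as Linked
open import Data.List.Relation.Unary.Unique.Propositional using (Unique)
import Data.List.Relation.Unary.Unique.Propositional.Properties as Unique
open import Data.List.Relation.Unary.Unique.DecPropositional (_≟_ {3}) using (unique?)
import Data.List.Relation.Unary.Unique.DecPropositional (Listₚ.≡-dec (Listₚ.≡-dec (_≟_ {3}))) as Unique₃
open import Data.Maybe using (just)
import Data.Maybe as Maybe
import Data.Maybe.Properties as Maybeₚ
open import Data.Nat using (ℕ; zero; suc; _+_; _≤_; _<_; s≤s; z≤n)
open import Data.Nat.Properties
  using (≤-refl; ≤-reflexive; ≤-trans; ≤-antisym; ≰⇒>; +-monoˡ-≤; +-monoʳ-≤; m≤n+m; +-suc; suc-injective;
         module ≤-Reasoning)
open import Data.Product using (∃; ∃₂; _×_; _,_; proj₁; proj₂)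
open import Data.Sum as Sum using (_⊎_; inj₁; inj₂; [_,_])
open import Data.Unit using (tt)
open import Function using (_∘_)
open import Function.Definitions using (Injective)
open import Relation.Nullary using (Dec; yes; no; does; ¬_; ¬?; contradiction)
open import Relation.Nullary.Decidable using (from-yes; _→-dec_; _×-dec_; dec-true; dec-false)
open import Relation.Binary.PropositionalEquality using (_≡_; _≢_; refl; sym; trans; cong; subst; subst₂)

private variable
  n : ℕ
  S : Fin n → Set
  x : Fin n
  r t u v w : Word n
  p q q₀ : List (Word n)
  k : ℕ

-- Adjacent swaps

Alike⇒↭ : Alike u v → u ↭ v
Alike⇒↭ (here x y w)  = swap x y ↭-refl
Alike⇒↭ (there z u~v) = prep z (Alike⇒↭ u~v)

Unique-alike : Alike u v → Unique u → Unique v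
Unique-alike (here x y w)  ((x≢y ∷ x∉w) ∷ y∉w ∷ uw) = ((x≢y ∘ sym) ∷ y∉w) ∷ x∉w ∷ uw
Unique-alike (there z u~v) (z∉u ∷ uu)                = All-resp-↭ (Alike⇒↭ u~v) z∉u ∷ Unique-alike u~v uu

linear-alike : Alike u v → IsLinOrderOn S u → IsLinOrderOn S v
linear-alike u~v (uu , mem) = Unique-alike u~v uu , λ x →
  (λ x∈v → proj₁ (mem x) (∈-resp-↭ (↭-sym (Alike⇒↭ u~v)) x∈v)) ,
  (λ Sx → ∈-resp-↭ (Alike⇒↭ u~v) (proj₂ (mem x) Sx))

linear-linked : IsLinOrderOn S r → Linked Alike (r ∷ p) → All (IsLinOrderOn S) (r ∷ p)
linear-linked lin [-]            = lin ∷ []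
linear-linked lin (r~v ∷ linked) = lin ∷ linear-linked (linear-alike r~v lin) linked

swaps : Word n → List (Word n)
swaps (x ∷ y ∷ w) = (y ∷ x ∷ w) ∷ map (x ∷_) (swaps (y ∷ w))
swaps _           = []

Alike⇒∈swaps : Alike u v → v ∈ swaps u
Alike⇒∈swaps (here x y w)               = here refl
Alike⇒∈swaps (there z u~v@(here _ _ _)) = there (∈-map⁺ (z ∷_) (Alike⇒∈swaps u~v))
Alike⇒∈swaps (there z u~v@(there _ _))  = there (∈-map⁺ (z ∷_) (Alike⇒∈swaps u~v))

∈swaps⇒Alike : v ∈ swaps u → Alike u v
∈swaps⇒Alike {u = x ∷ y ∷ w} (here refl) = here x y w
∈swaps⇒Alike {u = x ∷ y ∷ w} (there v∈) with ∈-map⁻ (x ∷_) v∈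
... | _ , v∈′ , refl = there x (∈swaps⇒Alike v∈′)

bit : Bool → ℕ
bit b = if b then 1 else 0

bit≤1 : ∀ b → bit b ≤ 1
bit≤1 true  = ≤-refl
bit≤1 false = z≤n

countRev-alike : ∀ {T} → Alike u v → countRev x u T ≡ countRev x v T
countRev-alike {x = x} {T = T} (here y z w) =
  x∙yz≈y∙xz (bit (above y x T)) (bit (above z x T)) (countRev x w T)
countRev-alike {x = x} {T = T} (there z u~v) = cong (bit (above z x T) +_) (countRev-alike u~v)

disc-alike : ∀ {T} → Alike u v → disc u T ≤ suc (disc v T)
disc-alike {T = T} (here x y w) = begin
  (bit (above y x T) + X) + (Y + W)       ≤⟨ +-monoˡ-≤ (Y + W) (+-monoˡ-≤ X (bit≤1 (above y x T))) ⟩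
  suc (X + (Y + W))                       ≡⟨ cong suc (x∙yz≈y∙xz X Y W) ⟩
  suc (Y + (X + W))                       ≤⟨ s≤s (+-monoˡ-≤ (X + W) (m≤n+m Y (bit (above x y T)))) ⟩
  suc ((bit (above x y T) + Y) + (X + W)) ∎
  where
  open ≤-Reasoning
  X = countRev x w T
  Y = countRev y w T
  W = disc w T
disc-alike {T = T} (there z {u} {v} u~v) = begin
  countRev z u T + disc u T       ≤⟨ +-monoʳ-≤ (countRev z u T) (disc-alike u~v) ⟩
  countRev z u T + suc (disc v T) ≡⟨ +-suc _ _ ⟩
  suc (countRev z u T + disc v T) ≡⟨ cong (λ m → suc (m + disc v T)) (countRev-alike u~v) ⟩
  suc (countRev z v T + disc v T) ∎
  where open ≤-Reasoning

-- Walks and geodesics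

walks : ℕ → Word n → List (List (Word n))
walks zero    r = (r ∷ []) ∷ []
walks (suc k) r = concatMap (λ v → map (r ∷_) (walks k v)) (swaps r)

∈-walks⁺ : Linked Alike (r ∷ p) → r ∷ p ∈ walks (length p) r
∈-walks⁺ [-]                    = here refl
∈-walks⁺ {r = r} (r~v ∷ linked) =
  ∈-concatMap⁺ _ (lose (Alike⇒∈swaps r~v) (∈-map⁺ (r ∷_) (∈-walks⁺ linked)))

∈-walks⁻ : q ∈ walks k r → ∃ λ p → q ≡ r ∷ p × length p ≡ k × Linked Alike q
∈-walks⁻ {k = zero}  (here refl) = [] , refl , refl , [-]
∈-walks⁻ {k = suc k} {r = r} q∈
  with find (∈-concatMap⁻ (λ v → map (r ∷_) (walks k v)) {xs = swaps r} q∈)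
... | v , v∈ , q∈′ with ∈-map⁻ (r ∷_) q∈′
... | q′ , q′∈ , refl with ∈-walks⁻ {k = k} {r = v} q′∈
... | p , refl , refl , linked = v ∷ p , refl , refl , ∈swaps⇒Alike v∈ ∷ linked

ends-at? : (t : Word n) (q : List (Word n)) → Dec (last q ≡ just t)
ends-at? t q = Maybeₚ.≡-dec (Listₚ.≡-dec _≟_) (last q) (just t)

geodesics : Word n → Word n → List (List (Word n))
geodesics r t = filter (ends-at? t) (walks (disc r t) r)

∈-geodesics⁻ : IsLinOrderOn S r → q ∈ geodesics r t → IsPath S r t q × length q ≡ suc (disc r t)
∈-geodesics⁻ {r = r} {t = t} lin q∈ with ∈-filter⁻ (ends-at? t) {xs = walks (disc r t) r} q∈
... | q∈walks , last≡ with ∈-walks⁻ {k = disc r t} {r = r} q∈walks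
... | _ , refl , len , linked = (linear-linked lin linked , refl , last≡ , linked) , cong suc len

∈-geodesics⁺ : IsPath S r t q → length q ≡ suc (disc r t) → q ∈ geodesics r t
∈-geodesics⁺ {r = r} {q = r ∷ p} (_ , refl , last≡ , linked) len =
  ∈-filter⁺ (ends-at? _) (subst (λ k → r ∷ p ∈ walks k r) (suc-injective len) (∈-walks⁺ linked)) last≡

disc<length : disc t t ≡ 0 → IsPath S r t p → disc r t < length p
disc<length {p = _ ∷ []}    t≡0 (_ , refl , refl , _) = s≤s (≤-reflexive t≡0)
disc<length {p = _ ∷ _ ∷ _} t≡0 (_ ∷ lins , refl , last≡ , r~v ∷ linked) =
  s≤s (≤-trans (disc-alike r~v) (disc<length t≡0 (lins , refl , last≡ , linked)))

∈-geodesics⇒geodesic : IsLinOrderOn S r → disc t t ≡ 0 → q ∈ geodesics r t → IsGeodesic S r t q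
∈-geodesics⇒geodesic lin t≡0 q∈ with ∈-geodesics⁻ lin q∈
... | path , len = path , λ _ path′ → ≤-trans (≤-reflexive len) (disc<length t≡0 path′)

geodesic⇒∈-geodesics : IsLinOrderOn S r → disc t t ≡ 0 → q₀ ∈ geodesics r t →
                       IsGeodesic S r t q → q ∈ geodesics r t
geodesic⇒∈-geodesics lin t≡0 q₀∈ (path , shortest) with ∈-geodesics⁻ lin q₀∈
... | path₀ , len₀ =
  ∈-geodesics⁺ path (≤-antisym (≤-trans (shortest _ path₀) (≤-reflexive len₀)) (disc<length t≡0 path))

-- Never conditions

Avoids : Fin n → ℕ → Word n → Set
Avoids v k w = at w k ≢ just v

avoids? : (v : Fin n) (k : ℕ) (w : Word n) → Dec (Avoids v k w)
avoids? v k w = ¬? (Maybeₚ.≡-dec _≟_ (at w k) (just v))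

Avoiding : (Fin n → Set) → Fin n → ℕ → Domain n → Set
Avoiding S v k E = ∀ w → E w → IsLinOrderOn S w × Avoids v k w

avoiding-∪ : ∀ {v k} {E F : Domain n} → Avoiding S v k E → Avoiding S v k F → Avoiding S v k (E ∪ F)
avoiding-∪ E-avoiding F-avoiding w = [ E-avoiding w , F-avoiding w ]

avoiding-K : ∀ {v k} → IsPath S r t p → All (Avoids v k) p → Avoiding S v k (K p)
avoiding-K (lins , _) avoids _ w∈p = All.lookup lins w∈p , All.lookup avoids w∈p

restrict-linear : ∀ {a b c : Fin n} {R} → IsLinOrderOn Full R → IsLinOrderOn (Tri a b c) (restrict a b c R)
restrict-linear {a = a} {b} {c} {R} (uniq , mem) = Unique.filter⁺ (tri? a b c) uniq , λ x →
  (λ x∈ → proj₂ (∈-filter⁻ (tri? a b c) {xs = R} x∈)) , (λ t → ∈-filter⁺ (tri? a b c) (proj₂ (mem x) tt) t)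

restrict-id : ∀ {x y z : Fin n} → IsLinOrderOn S w → (∀ {u} → S u → Tri x y z u) → restrict x y z w ≡ w
restrict-id {x = x} {y} {z} (_ , mem) S⊆xyz =
  Listₚ.filter-all (tri? x y z) (All.tabulate λ {u} u∈ → S⊆xyz (proj₁ (mem u) u∈))

-- Relabelling

module _ {m} (f : Fin m → Fin n) where

  Alike-map⁺ : {u v : Word m} → Alike u v → Alike (map f u) (map f v)
  Alike-map⁺ (here x y w)  = here (f x) (f y) (map f w)
  Alike-map⁺ (there z u~v) = there (f z) (Alike-map⁺ u~v)

  Alike-map⁻ : ∀ {u : Word m} {w} → Alike (map f u) w → ∃ λ v → w ≡ map f v × Alike u v
  Alike-map⁻ {x ∷ y ∷ u} (here _ _ _)   = y ∷ x ∷ u , refl , here x y u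
  Alike-map⁻ {x ∷ u}     (there _ fu~w) with Alike-map⁻ fu~w
  ... | v , refl , u~v = x ∷ v , refl , there x u~v

  at-map : ∀ (w : Word m) k → at (map f w) k ≡ Maybe.map f (at w k)
  at-map []      _             = refl
  at-map (x ∷ w) zero          = refl
  at-map (x ∷ w) (suc zero)    = refl
  at-map (x ∷ w) (suc (suc k)) = at-map w (suc k)

  avoids-map⁻ : ∀ {v k} (w : Word m) → Avoids (f v) k (map f w) → Avoids v k w
  avoids-map⁻ w fv∉ v∈ = fv∉ (trans (at-map w _) (cong (Maybe.map f) v∈))

  module _ (f-injective : Injective _≡_ _≡_ f) where

    Alike-map⁻-injective : {u v : Word m} → Alike (map f u) (map f v) → Alike u v
    Alike-map⁻-injective fu~fv with Alike-map⁻ fu~fv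
    ... | _ , fv≡fv′ , u~v′ rewrite Listₚ.map-injective f-injective fv≡fv′ = u~v′

    avoids-map⁺ : ∀ {v k} (w : Word m) → Avoids v k w → Avoids (f v) k (map f w)
    avoids-map⁺ w v∉ fv∈ = v∉ (Maybeₚ.map-injective f-injective (trans (sym (at-map w _)) fv∈))

    does-≟-map : ∀ x y → does (f x ≟ f y) ≡ does (x ≟ y)
    does-≟-map x y with x ≟ y
    ... | yes refl = dec-true (f x ≟ f x) refl
    ... | no x≢y   = dec-false (f x ≟ f y) (x≢y ∘ f-injective)

    elem-map : ∀ x (w : Word m) → elem (f x) (map f w) ≡ elem x w
    elem-map x []      = refl
    elem-map x (z ∷ w) rewrite does-≟-map z x | elem-map x w = refl

    above-map : ∀ x y (w : Word m) → above (f x) (f y) (map f w) ≡ above x y w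
    above-map x y []      = refl
    above-map x y (z ∷ w) rewrite does-≟-map z x | does-≟-map z y | elem-map y w | above-map x y w = refl

    countRev-map : ∀ x (R T : Word m) → countRev (f x) (map f R) (map f T) ≡ countRev x R T
    countRev-map x []      T = refl
    countRev-map x (y ∷ R) T rewrite above-map y x T | countRev-map x R T = refl

    disc-map : ∀ (R T : Word m) → disc (map f R) (map f T) ≡ disc R T
    disc-map []      T = refl
    disc-map (x ∷ R) T rewrite countRev-map x R T | disc-map R T = refl

-- Orders of three alternatives

pattern 0₃ = zero
pattern 1₃ = suc zero
pattern 2₃ = suc (suc zero)

-- Listed around the hexagon: cyclically consecutive orders are alike.
order : Fin 6 → Word 3
order = lookup ( (0₃ ∷ 1₃ ∷ 2₃ ∷ []) ∷ (0₃ ∷ 2₃ ∷ 1₃ ∷ []) ∷ (2₃ ∷ 0₃ ∷ 1₃ ∷ [])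
               ∷ (2₃ ∷ 1₃ ∷ 0₃ ∷ []) ∷ (1₃ ∷ 2₃ ∷ 0₃ ∷ []) ∷ (1₃ ∷ 0₃ ∷ 2₃ ∷ []) ∷ [])

order-linear : ∀ i → IsLinOrderOn Full (order i)
order-linear i = from-yes (all? λ i → unique? (order i)) i ,
                 λ x → (λ _ → tt) , (λ _ → from-yes (all? λ i → all? λ x → x ∈? order i) i x)

not-covering₁ : ∀ x → ¬ (∀ i → i ∈ x ∷ [])
not-covering₁ = from-yes (all? λ x → ¬? (all? λ i → i ∈? x ∷ []))

not-covering₂ : ∀ x y → ¬ (∀ i → i ∈ x ∷ y ∷ [])
not-covering₂ = from-yes (all? λ x → all? λ y → ¬? (all? λ i → i ∈? x ∷ y ∷ []))

unique₃ : ∀ x y z → Unique (x ∷ y ∷ z ∷ []) → ∃ λ i → x ∷ y ∷ z ∷ [] ≡ order i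
unique₃ = from-yes (all? λ x → all? λ y → all? λ z →
  unique? (x ∷ y ∷ z ∷ []) →-dec any? λ i → Listₚ.≡-dec _≟_ (x ∷ y ∷ z ∷ []) (order i))

not-unique₄ : ∀ x y z w → ¬ Unique (x ∷ y ∷ z ∷ w ∷ [])
not-unique₄ = from-yes (all? λ x → all? λ y → all? λ z → all? λ w → ¬? (unique? (x ∷ y ∷ z ∷ w ∷ [])))

linear₃ : ∀ {u} → IsLinOrderOn Full u → ∃ λ i → u ≡ order i
linear₃ {[]}                (_ , mem)  = contradiction (proj₂ (mem 0₃) tt) λ ()
linear₃ {x ∷ []}            (_ , mem)  = ⊥-elim (not-covering₁ x λ i → proj₂ (mem i) tt)
linear₃ {x ∷ y ∷ []}        (_ , mem)  = ⊥-elim (not-covering₂ x y λ i → proj₂ (mem i) tt)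
linear₃ {x ∷ y ∷ z ∷ []}    (uniq , _) = unique₃ x y z uniq
linear₃ {x ∷ y ∷ z ∷ w ∷ _} (uniq , _) = ⊥-elim (not-unique₄ x y z w (Unique.take⁺ 4 uniq))

tri-cover₃ : ∀ (i j k : Fin 3) → i ≢ j → j ≢ k → i ≢ k → ∀ l → Tri i j k l
tri-cover₃ = from-yes (all? λ (i : Fin 3) → all? λ j → all? λ k →
  ¬? (i ≟ j) →-dec ¬? (j ≟ k) →-dec ¬? (i ≟ k) →-dec all? (tri? i j k))

disc-self₃ : ∀ i → disc (order i) (order i) ≡ 0
disc-self₃ = from-yes (all? λ i → disc (order i) (order i) ℕₚ.≟ 0)

disc≤3₃ : ∀ i j → disc (order i) (order j) ≤ 3
disc≤3₃ = from-yes (all? λ i → all? λ j → disc (order i) (order j) ℕₚ.≤? 3)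

geodesics-near₃ : ∀ i j → disc (order i) (order j) ≤ 2 → length (geodesics (order i) (order j)) ≡ 1
geodesics-near₃ = from-yes (all? λ i → all? λ j →
  disc (order i) (order j) ℕₚ.≤? 2 →-dec length (geodesics (order i) (order j)) ℕₚ.≟ 1)

geodesics-far₃ : ∀ i j → disc (order i) (order j) ≡ 3 →
                 length (geodesics (order i) (order j)) ≡ 2 × Unique (geodesics (order i) (order j))
geodesics-far₃ = from-yes (all? λ i → all? λ j →
  disc (order i) (order j) ℕₚ.≟ 3 →-dec
    (length (geodesics (order i) (order j)) ℕₚ.≟ 2 ×-dec Unique₃.unique? (geodesics (order i) (order j))))

AvoidingGeodesic : Fin 6 → Fin 6 → Fin 3 → ℕ → Set
AvoidingGeodesic i j v k =
  Avoids v k (order i) → Avoids v k (order j) → Any (All (Avoids v k)) (geodesics (order i) (order j))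

avoiding-geodesic₁₃ : ∀ i j v → AvoidingGeodesic i j v 1 × AvoidingGeodesic i j v 3
avoiding-geodesic₁₃ = from-yes (all? λ i → all? λ j → all? λ v → dec i j v 1 ×-dec dec i j v 3)
  where
  dec : ∀ i j v k → Dec (AvoidingGeodesic i j v k)
  dec i j v k = avoids? v k (order i) →-dec avoids? v k (order j) →-dec
                Any.any? (All.all? (avoids? v k)) (geodesics (order i) (order j))

avoiding-geodesic₃ : ∀ i j v k → k ≡ 1 ⊎ k ≡ 3 → AvoidingGeodesic i j v k
avoiding-geodesic₃ i j v _ (inj₁ refl) = proj₁ (avoiding-geodesic₁₃ i j v)
avoiding-geodesic₃ i j v _ (inj₂ refl) = proj₂ (avoiding-geodesic₁₃ i j v)

-- The only geodesic from abc to cab is abc, acb, cab, and the only one from abc to bca is abc, bac, bca.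
acb-between₃ : ∀ v k → k ≡ 1 ⊎ k ≡ 3 →
               Avoids v k (order (# 0)) → Avoids v k (order (# 2)) → Avoids v k (order (# 1))
acb-between₃ v k k13 abc cab with avoiding-geodesic₃ (# 0) (# 2) v k k13 abc cab
... | here (_ ∷ acb ∷ _) = acb

bac-between₃ : ∀ v k → k ≡ 1 ⊎ k ≡ 3 →
               Avoids v k (order (# 0)) → Avoids v k (order (# 4)) → Avoids v k (order (# 5))
bac-between₃ v k k13 abc bca with avoiding-geodesic₃ (# 0) (# 4) v k k13 abc bca
... | here (_ ∷ bac ∷ _) = bac

module _ {A : Set} where

  length≡suc⇒∈ : ∀ {xs : List A} {m} → length xs ≡ suc m → ∃ λ x → x ∈ xs
  length≡suc⇒∈ {x ∷ _} _ = x , here refl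

  length≡1⇒≡ : ∀ {xs : List A} {x y} → length xs ≡ 1 → x ∈ xs → y ∈ xs → x ≡ y
  length≡1⇒≡ {_ ∷ []} _ (here refl) (here refl) = refl

  length≡2⇒pair : ∀ {xs : List A} → length xs ≡ 2 → Unique xs →
                  ∃₂ λ x y → x ≢ y × x ∈ xs × y ∈ xs × (∀ {z} → z ∈ xs → z ≡ x ⊎ z ≡ y)
  length≡2⇒pair {x ∷ y ∷ []} _ ((x≢y ∷ []) ∷ _) = x , y , x≢y , here refl , there (here refl) , λ where
    (here refl)         → inj₁ refl
    (there (here refl)) → inj₂ refl

some-geodesic₃ : ∀ i j → ∃ λ q → q ∈ geodesics (order i) (order j)
some-geodesic₃ i j with disc (order i) (order j) ℕₚ.≤? 2
... | yes d≤2 = length≡suc⇒∈ (geodesics-near₃ i j d≤2)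
... | no d≰2  = length≡suc⇒∈ (proj₁ (geodesics-far₃ i j (≤-antisym (disc≤3₃ i j) (≰⇒> d≰2))))

geodesic₃⇒∈ : ∀ i j {q} → IsGeodesic Full (order i) (order j) q → q ∈ geodesics (order i) (order j)
geodesic₃⇒∈ i j = geodesic⇒∈-geodesics (order-linear i) (disc-self₃ j) (proj₂ (some-geodesic₃ i j))

∈⇒geodesic₃ : ∀ i j {q} → q ∈ geodesics (order i) (order j) → IsGeodesic Full (order i) (order j) q
∈⇒geodesic₃ i j = ∈-geodesics⇒geodesic (order-linear i) (disc-self₃ j)

module Relabel {n} {a b c : Fin n} (a≢b : a ≢ b) (b≢c : b ≢ c) (a≢c : a ≢ c) where

  σ : Fin 3 → Fin n
  σ 0₃ = a
  σ 1₃ = b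
  σ 2₃ = c

  σ* : Word 3 → Word n
  σ* = map σ

  σ-injective : Injective _≡_ _≡_ σ
  σ-injective {0₃} {0₃} _ = refl
  σ-injective {0₃} {1₃}   = ⊥-elim ∘ a≢b
  σ-injective {0₃} {2₃}   = ⊥-elim ∘ a≢c
  σ-injective {1₃} {0₃}   = ⊥-elim ∘ a≢b ∘ sym
  σ-injective {1₃} {1₃} _ = refl
  σ-injective {1₃} {2₃}   = ⊥-elim ∘ b≢c
  σ-injective {2₃} {0₃}   = ⊥-elim ∘ a≢c ∘ sym
  σ-injective {2₃} {1₃}   = ⊥-elim ∘ b≢c ∘ sym
  σ-injective {2₃} {2₃} _ = refl

  σ*-injective : Injective _≡_ _≡_ σ*
  σ*-injective = Listₚ.map-injective σ-injective

  Tri-σ : ∀ i → Tri a b c (σ i)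
  Tri-σ 0₃ = inj₁ refl
  Tri-σ 1₃ = inj₂ (inj₁ refl)
  Tri-σ 2₃ = inj₂ (inj₂ refl)

  label : ∀ {x} → Tri a b c x → ∃ λ i → σ i ≡ x
  label (inj₁ refl)        = 0₃ , refl
  label (inj₂ (inj₁ refl)) = 1₃ , refl
  label (inj₂ (inj₂ refl)) = 2₃ , refl

  unlabel : ∀ {w} → All (Tri a b c) w → ∃ λ u → w ≡ σ* u
  unlabel []       = [] , refl
  unlabel (t ∷ ts) with label t | unlabel ts
  ... | i , refl | u , refl = i ∷ u , refl

  linear-map⁺ : ∀ {u} → IsLinOrderOn Full u → IsLinOrderOn (Tri a b c) (σ* u)
  linear-map⁺ {u} (uniq , mem) = Unique.map⁺ σ-injective uniq , λ x → Tri-of-∈ , ∈-of-Tri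
    where
    Tri-of-∈ : ∀ {x} → x ∈ σ* u → Tri a b c x
    Tri-of-∈ x∈ with ∈-map⁻ σ x∈
    ... | i , _ , refl = Tri-σ i
    ∈-of-Tri : ∀ {x} → Tri a b c x → x ∈ σ* u
    ∈-of-Tri t with label t
    ... | i , refl = ∈-map⁺ σ (proj₂ (mem i) tt)

  linear-map⁻ : ∀ {w} → IsLinOrderOn (Tri a b c) w → ∃ λ u → w ≡ σ* u × IsLinOrderOn Full u
  linear-map⁻ (uniq , mem) with unlabel (All.tabulate λ {x} x∈ → proj₁ (mem x) x∈)
  ... | u , refl = u , refl , Unique.map⁻ uniq , λ i → (λ _ → tt) , λ _ → ∈-unmap (proj₂ (mem (σ i)) (Tri-σ i))
    where
    ∈-unmap : ∀ {i} → σ i ∈ σ* u → i ∈ u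
    ∈-unmap σi∈ with ∈-map⁻ σ σi∈
    ... | _ , j∈ , σi≡σj = subst (_∈ u) (sym (σ-injective σi≡σj)) j∈

  All-linear-map⁻ : All (IsLinOrderOn (Tri a b c)) p → ∃ λ q → p ≡ map σ* q × All (IsLinOrderOn Full) q
  All-linear-map⁻ []           = [] , refl , []
  All-linear-map⁻ (lin ∷ lins) with linear-map⁻ lin | All-linear-map⁻ lins
  ... | u , refl , lin₃ | q , refl , lins₃ = u ∷ q , refl , lin₃ ∷ lins₃

  decode : ∀ {w} → IsLinOrderOn (Tri a b c) w → ∃ λ i → w ≡ σ* (order i)
  decode lin with linear-map⁻ lin
  ... | _ , refl , lin₃ with linear₃ lin₃
  ... | i , refl = i , refl

  path-map⁺ : ∀ {r t q} → IsPath Full r t q → IsPath (Tri a b c) (σ* r) (σ* t) (map σ* q)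
  path-map⁺ {q = q} (lins , hd , lst , linked) =
    All.map⁺ (All.map linear-map⁺ lins) ,
    trans (Listₚ.head-map q) (cong (Maybe.map σ*) hd) ,
    trans (Listₚ.last-map σ* q) (cong (Maybe.map σ*) lst) ,
    Linked.map⁺ (Linked.map (Alike-map⁺ σ) linked)

  path-map⁻ : ∀ {r t p} → IsPath (Tri a b c) (σ* r) (σ* t) p → ∃ λ q → p ≡ map σ* q × IsPath Full r t q
  path-map⁻ (lins , hd , lst , linked) with All-linear-map⁻ lins
  ... | q , refl , lins₃ = q , refl , lins₃ ,
    Maybeₚ.map-injective σ*-injective (trans (sym (Listₚ.head-map q)) hd) ,
    Maybeₚ.map-injective σ*-injective (trans (sym (Listₚ.last-map σ* q)) lst) ,
    Linked.map (Alike-map⁻-injective σ σ-injective) (Linked.map⁻ linked)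

  geodesic-map⁺ : ∀ {r t q} → IsGeodesic Full r t q → IsGeodesic (Tri a b c) (σ* r) (σ* t) (map σ* q)
  geodesic-map⁺ {r} {t} {q} (path , shortest) = path-map⁺ path , shorter
    where
    shorter : ∀ p → IsPath (Tri a b c) (σ* r) (σ* t) p → length (map σ* q) ≤ length p
    shorter p path′ with path-map⁻ path′
    ... | q′ , refl , path₃ =
      subst₂ _≤_ (sym (Listₚ.length-map σ* q)) (sym (Listₚ.length-map σ* q′)) (shortest q′ path₃)

  geodesic-map⁻ : ∀ {r t p} → IsGeodesic (Tri a b c) (σ* r) (σ* t) p →
                  ∃ λ q → p ≡ map σ* q × IsGeodesic Full r t q
  geodesic-map⁻ (path , shortest) with path-map⁻ path
  ... | q , refl , path₃ = q , refl , path₃ , λ q′ path′ →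
    subst₂ _≤_ (Listₚ.length-map σ* q) (Listₚ.length-map σ* q′) (shortest _ (path-map⁺ path′))

  geodesic⇒∈ : ∀ i j {p} → IsGeodesic (Tri a b c) (σ* (order i)) (σ* (order j)) p →
               ∃ λ q → p ≡ map σ* q × q ∈ geodesics (order i) (order j)
  geodesic⇒∈ i j geo with geodesic-map⁻ geo
  ... | q , refl , geo₃ = q , refl , geodesic₃⇒∈ i j geo₃

  ∈⇒geodesic : ∀ i j {q} → q ∈ geodesics (order i) (order j) →
               IsGeodesic (Tri a b c) (σ* (order i)) (σ* (order j)) (map σ* q)
  ∈⇒geodesic i j = geodesic-map⁺ ∘ ∈⇒geodesic₃ i j

  disc-σ : ∀ i j → disc (σ* (order i)) (σ* (order j)) ≡ disc (order i) (order j)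
  disc-σ i j = disc-map σ σ-injective (order i) (order j)

  module _ {R T} (R-linear : IsLinOrderOn (Tri a b c) R) (T-linear : IsLinOrderOn (Tri a b c) T) where

    geodesic-avoiding : ∀ {v k} → k ≡ 1 ⊎ k ≡ 3 → Avoids (σ v) k R → Avoids (σ v) k T →
                        ∃ λ p → IsGeodesic (Tri a b c) R T p × All (Avoids (σ v) k) p
    geodesic-avoiding {v} {k} k13 R-avoids T-avoids with decode R-linear | decode T-linear
    ... | i , refl | j , refl
      with find (avoiding-geodesic₃ i j v k k13 (avoids-map⁻ σ (order i) R-avoids)
                                                (avoids-map⁻ σ (order j) T-avoids))
    ... | q , q∈ , q-avoids =
      map σ* q , ∈⇒geodesic i j q∈ , All.map⁺ (All.map (λ {w} → avoids-map⁺ σ σ-injective w) q-avoids)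

    geodesic-unique : disc R T ≤ 2 → ∀ {p p′} →
                      IsGeodesic (Tri a b c) R T p → IsGeodesic (Tri a b c) R T p′ → p ≡ p′
    geodesic-unique d≤2 geo geo′ with decode R-linear | decode T-linear
    ... | i , refl | j , refl with geodesic⇒∈ i j geo | geodesic⇒∈ i j geo′
    ... | q , refl , q∈ | q′ , refl , q′∈ =
      cong (map σ*) (length≡1⇒≡ (geodesics-near₃ i j (subst (_≤ 2) (disc-σ i j) d≤2)) q∈ q′∈)

    geodesic-pair : disc R T ≡ 3 →
      ∃₂ λ p q → IsGeodesic (Tri a b c) R T p × IsGeodesic (Tri a b c) R T q × p ≢ q
               × (∀ r → IsGeodesic (Tri a b c) R T r → r ≡ p ⊎ r ≡ q)
    geodesic-pair d≡3 with decode R-linear | decode T-linear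
    ... | i , refl | j , refl with geodesics-far₃ i j (trans (sym (disc-σ i j)) d≡3)
    ... | two , distinct with length≡2⇒pair two distinct
    ... | q , q′ , q≢q′ , q∈ , q′∈ , only =
      map σ* q , map σ* q′ , ∈⇒geodesic i j q∈ , ∈⇒geodesic i j q′∈ ,
      q≢q′ ∘ Listₚ.map-injective σ*-injective , geodesic-among
      where
      geodesic-among : ∀ r → IsGeodesic (Tri a b c) _ _ r → r ≡ map σ* q ⊎ r ≡ map σ* q′
      geodesic-among r geo with geodesic⇒∈ i j geo
      ... | _ , refl , r∈ = Sum.map (cong (map σ*)) (cong (map σ*)) (only r∈)

  acb-between : ∀ {v k} → k ≡ 1 ⊎ k ≡ 3 →
                Avoids (σ v) k (a ∷ b ∷ c ∷ []) → Avoids (σ v) k (c ∷ a ∷ b ∷ []) → Avoids (σ v) k (a ∷ c ∷ b ∷ [])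
  acb-between {v} {k} k13 abc cab = avoids-map⁺ σ σ-injective {k = k} (order (# 1))
    (acb-between₃ v k k13 (avoids-map⁻ σ {k = k} (order (# 0)) abc) (avoids-map⁻ σ {k = k} (order (# 2)) cab))

  bac-between : ∀ {v k} → k ≡ 1 ⊎ k ≡ 3 →
                Avoids (σ v) k (a ∷ b ∷ c ∷ []) → Avoids (σ v) k (b ∷ c ∷ a ∷ []) → Avoids (σ v) k (b ∷ a ∷ c ∷ [])
  bac-between {v} {k} k13 abc bca = avoids-map⁺ σ σ-injective {k = k} (order (# 5))
    (bac-between₃ v k k13 (avoids-map⁻ σ {k = k} (order (# 0)) abc) (avoids-map⁻ σ {k = k} (order (# 4)) bca))

  tri-cover : ∀ {x y z} → Tri a b c x → Tri a b c y → Tri a b c z → x ≢ y → y ≢ z → x ≢ z →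
              ∀ {u} → Tri a b c u → Tri x y z u
  tri-cover tx ty tz x≢y y≢z x≢z tu with label tx | label ty | label tz | label tu
  ... | i , refl | j , refl | k , refl | l , refl = Sum.map (cong σ) (Sum.map (cong σ) (cong σ))
    (tri-cover₃ i j k (x≢y ∘ cong σ) (y≢z ∘ cong σ) (x≢z ∘ cong σ) l)

  peakPit-avoiding : ∀ {E v k} → k ≡ 1 ⊎ k ≡ 3 → Avoiding (Tri a b c) (σ v) k E → PeakPit (Tri a b c) E
  peakPit-avoiding {E} {v} {k} k13 E-avoiding = (λ w → proj₁ ∘ E-avoiding w) , never
    where
    never : ∀ x y z → Tri a b c x → Tri a b c y → Tri a b c z → x ≢ y → y ≢ z → x ≢ z →
            ∃ λ v′ → ∃ λ k′ → Tri x y z v′ × (k′ ≡ 1 ⊎ k′ ≡ 3) × Never E x y z v′ k′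
    never x y z tx ty tz x≢y y≢z x≢z = σ v , k , cover (Tri-σ v) , k13 , λ w w∈E →
      subst (Avoids (σ v) k) (sym (restrict-id (proj₁ (E-avoiding w w∈E)) cover)) (proj₂ (E-avoiding w w∈E))
      where
      cover : ∀ {u} → Tri a b c u → Tri x y z u
      cover = tri-cover tx ty tz x≢y y≢z x≢z

  module Extension {E : Domain n} {v k} (k13 : k ≡ 1 ⊎ k ≡ 3) (E-avoiding : Avoiding (Tri a b c) (σ v) k E) where

    extend : ∀ {F} → Avoiding (Tri a b c) (σ v) k F → PeakPit (Tri a b c) (E ∪ F)
    extend F-avoiding = peakPit-avoiding k13 (avoiding-∪ E-avoiding F-avoiding)

    linear : ∀ {R} → E R → IsLinOrderOn (Tri a b c) R
    linear R∈E = proj₁ (E-avoiding _ R∈E)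

    avoids : ∀ {R} → E R → Avoids (σ v) k R
    avoids R∈E = proj₂ (E-avoiding _ R∈E)

    acb-extension : E (a ∷ b ∷ c ∷ []) → E (c ∷ a ∷ b ∷ []) → PeakPit (Tri a b c) (E ∪ ｛ a ∷ c ∷ b ∷ [] ｝)
    acb-extension abc∈E cab∈E = extend λ where
      _ refl → linear-map⁺ (order-linear (# 1)) , acb-between k13 (avoids abc∈E) (avoids cab∈E)

    bac-extension : E (a ∷ b ∷ c ∷ []) → E (b ∷ c ∷ a ∷ []) → PeakPit (Tri a b c) (E ∪ ｛ b ∷ a ∷ c ∷ [] ｝)
    bac-extension abc∈E bca∈E = extend λ where
      _ refl → linear-map⁺ (order-linear (# 5)) , bac-between k13 (avoids abc∈E) (avoids bca∈E)

    geodesic-extension : ∀ R T → E R → E T →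
      ∃ λ p → IsGeodesic (Tri a b c) R T p × PeakPit (Tri a b c) (E ∪ K p)
    geodesic-extension R T R∈E T∈E
      with geodesic-avoiding (linear R∈E) (linear T∈E) k13 (avoids R∈E) (avoids T∈E)
    ... | p , geo , p-avoids = p , geo , extend (avoiding-K (proj₁ geo) p-avoids)

    unique-geodesic-extension : ∀ R T → E R → E T → disc R T ≤ 2 →
      ∃ λ p → IsGeodesic (Tri a b c) R T p × (∀ q → IsGeodesic (Tri a b c) R T q → q ≡ p)
            × PeakPit (Tri a b c) (E ∪ K p)
    unique-geodesic-extension R T R∈E T∈E d≤2 with geodesic-extension R T R∈E T∈E
    ... | p , geo , peakPit =
      p , geo , (λ q geo′ → geodesic-unique (linear R∈E) (linear T∈E) d≤2 geo′ geo) , peakPit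

    two-geodesics-extension : ∀ R T → E R → E T → disc R T ≡ 3 →
      ∃ λ p → ∃ λ q → IsGeodesic (Tri a b c) R T p × IsGeodesic (Tri a b c) R T q × p ≢ q
            × (∀ r → IsGeodesic (Tri a b c) R T r → r ≡ p ⊎ r ≡ q)
            × (PeakPit (Tri a b c) (E ∪ K p) ⊎ PeakPit (Tri a b c) (E ∪ K q))
    two-geodesics-extension R T R∈E T∈E d≡3
      with geodesic-pair (linear R∈E) (linear T∈E) d≡3 | geodesic-extension R T R∈E T∈E
    ... | p , q , geo-p , geo-q , p≢q , only | r , geo-r , peakPit =
      p , q , geo-p , geo-q , p≢q , only ,
      Sum.map (λ r≡p → subst (λ s → PeakPit (Tri a b c) (E ∪ K s)) r≡p peakPit)
              (λ r≡q → subst (λ s → PeakPit (Tri a b c) (E ∪ K s)) r≡q peakPit) (only r geo-r)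
lemma11 : ∀ (n : ℕ) (D : Domain n) (a b c : Fin n) →
    PeakPit Full D → a ≢ b → b ≢ c → a ≢ c →
    -- (a)
    ((Restr D a b c (a ∷ b ∷ c ∷ []) → Restr D a b c (c ∷ a ∷ b ∷ []) →
        PeakPit (Tri a b c) (Restr D a b c ∪ ｛ a ∷ c ∷ b ∷ [] ｝))
     × (Restr D a b c (a ∷ b ∷ c ∷ []) → Restr D a b c (b ∷ c ∷ a ∷ []) →
        PeakPit (Tri a b c) (Restr D a b c ∪ ｛ b ∷ a ∷ c ∷ [] ｝)))
    -- (b)
    × (∀ R T → Restr D a b c R → Restr D a b c T → disc R T ≤ 2 →
        ∃ λ p → IsGeodesic (Tri a b c) R T p
          × (∀ q → IsGeodesic (Tri a b c) R T q → q ≡ p)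
          × PeakPit (Tri a b c) (Restr D a b c ∪ K p))
    -- (c)
    × (∀ R T → Restr D a b c R → Restr D a b c T → disc R T ≡ 3 →
        ∃ λ p → ∃ λ q → IsGeodesic (Tri a b c) R T p × IsGeodesic (Tri a b c) R T q
          × p ≢ q
          × (∀ r → IsGeodesic (Tri a b c) R T r → r ≡ p ⊎ r ≡ q)
          × (PeakPit (Tri a b c) (Restr D a b c ∪ K p)
             ⊎ PeakPit (Tri a b c) (Restr D a b c ∪ K q)))
    -- (d)
    × (∀ R T → Restr D a b c R → Restr D a b c T →
        ∃ λ p → IsGeodesic (Tri a b c) R T p
          × PeakPit (Tri a b c) (Restr D a b c ∪ K p))
lemma11 n D a b c D-peakPit a≢b b≢c a≢c with proj₂ D-peakPit a b c tt tt tt a≢b b≢c a≢c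
... | _ , k , tv , k13 , never with Relabel.label a≢b b≢c a≢c tv
... | v , refl =
  (acb-extension , bac-extension) , unique-geodesic-extension , two-geodesics-extension , geodesic-extension
  where
  open Relabel a≢b b≢c a≢c

  D-avoiding : Avoiding (Tri a b c) (σ v) k (Restr D a b c)
  D-avoiding _ (R , R∈D , refl) = restrict-linear (proj₁ D-peakPit R R∈D) , never R R∈D

  open Extension k13 D-avoiding
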